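{- Let $\ell,n$ be positive integers with $2^\ell\le n$. If $A\subseteq\mathbb{Z}_{2^n}$ satisfies $|A|>\left(1-\frac{1}{2^\ell}\right)2^n$, then there exist integers $x,y$ such that $\Sigma^*\{x,x,\dots,x,y\}\subseteq A$, where $x$ appears $2^\ell-1$ times in the multiset.
   Context: $\mathbb{Z}_{2^n}$ is the cyclic group of integers modulo $2^n$. For a multiset $S=\{a_1,\dots,a_d\}$ of not necessarily distinct integers, $\Sigma^*S=\{\sum_{i\in I}a_i \bmod 2^n : \emptyset\neq I\subseteq\{1,\dots,d\}\}$, viewed as a subset of $\mathbb{Z}_{2^n}$. Thus $\Sigma^*\{x,\dots,x,y\}$ (with $2^\ell-1$ copies of $x$) equals $\{jx: 1\le j\le 2^\ell-1\}\cup\{y+jx: 0\le j\le 2^\ell-1\}$ modulo $2^n$. -}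

module Defs where

open import Data.Nat as ℕ using (ℕ; _^_; NonZero)
open import Data.Integer as ℤ using (ℤ; _+_; _%ℕ_)
open import Data.Fin using (Fin)
open import Data.Fin.Subset using (Subset; _∈_; Nonempty)
open import Data.List using (List; []; _∷_; replicate)
open import Data.Vec as Vec using (Vec; fromList)
open import Data.Bool using (Bool; true; false)
open import Data.Product using (Σ; _×_; _,_)
open import Relation.Binary.PropositionalEquality using (_≡_)
open import Data.Nat.DivMod using (_mod_)

selSum : ∀ {d} → Subset d → Vec ℤ d → ℤ
selSum Vec.[] Vec.[] = ℤ.+ 0
selSum (true Vec.∷ I) (a Vec.∷ as) = a + selSum I as
selSum (false Vec.∷ I) (a Vec.∷ as) = selSum I as

reduce : (m : ℕ) → .{{_ : NonZero m}} → ℤ → Fin m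
reduce m z = (z %ℕ m) mod m

Σ* : (m : ℕ) → .{{_ : NonZero m}} → ∀ {d} → Vec ℤ d → Fin m → Set
Σ* m {d} S t = Σ (Subset d) λ I → Nonempty I × (reduce m (selSum I S) ≡ t)

xsy : ℕ → ℤ → ℤ → List ℤ
xsy k x y = replicate k x Data.List.++ (y ∷ [])

module Submission where

-- Theorem 2.1.  Put N = 2^n, L = 2^ℓ and let B = ℤ_N ∖ A; the density hypothesis says
-- precisely that L·|B| < N.  Every nonempty subset sum of {x,…,x,y} (L-1 copies of x)
-- is c·x with 1 ≤ c < L or c·x + y with 0 ≤ c < L, so it suffices to find
--   (1) an x such that c·x ∉ B for all 1 ≤ c < L, and then
--   (2) a y such that c·x + y ∉ B for all 0 ≤ c < L.
-- Both are found by counting bad candidates in ℤ_N.  For (2), every pair (c, b ∈ B)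
-- forbids exactly one y, so at most L·|B| < N values of y are bad.  For (1) we take x
-- odd; the key lemma `multiplierBound` says that, as long as ℓ ≤ n, for a fixed target b
-- there are at most L/2 pairs (c, x) with 1 ≤ c < L, x odd and c·x ≡ b (mod N).  Hence
-- at most N/2 + |B|·L/2 < N values of x are even or bad.

open import Defs
open import Data.Nat using (ℕ; _^_; _*_; _∸_; _≤_; _<_; NonZero)
open import Data.Nat.Properties using (m^n≢0)
open import Data.Integer using (ℤ)
open import Data.Fin using (Fin)
open import Data.Fin.Subset using (Subset; _∈_; ∣_∣)
open import Data.Vec using (fromList)
open import Data.Product using (∃₂)

module Counting where

  open import Data.Nat
  open import Data.Nat.Properties
  open import Data.Bool using (Bool; true; false; _∨_; _∧_)
  open import Data.Bool.Properties using (∨-zeroʳ; ∨-conicalˡ; ∨-conicalʳ; T-≡)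
  open import Function.Bundles using (Equivalence)
  open import Data.List using (List; []; _∷_)
  open import Data.List.Relation.Unary.Any using (Any; here; there)
  open import Data.Product using (∃; _×_; _,_)
  open import Relation.Binary.PropositionalEquality
  open import Data.Empty using (⊥-elim)
  open import Relation.Nullary using (yes; no)
  open import Data.Nat.Tactic.RingSolver using (solve-∀)

  𝟙 : Bool → ℕ
  𝟙 true = 1
  𝟙 false = 0

  count : (ℕ → Bool) → ℕ → ℕ
  count p zero = 0
  count p (suc m) = 𝟙 (p m) + count p m

  𝟙-∨ : ∀ a b → 𝟙 (a ∨ b) ≤ 𝟙 a + 𝟙 b
  𝟙-∨ true b = s≤s z≤n
  𝟙-∨ false b = ≤-refl

  ≡ᵇ-true⇒≡ : ∀ {m n} → (m ≡ᵇ n) ≡ true → m ≡ n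
  ≡ᵇ-true⇒≡ {m} {n} e = ≡ᵇ⇒≡ m n (Equivalence.from T-≡ e)

  ≡⇒≡ᵇ-true : ∀ {m n} → m ≡ n → (m ≡ᵇ n) ≡ true
  ≡⇒≡ᵇ-true {m} {n} e = Equivalence.to T-≡ (≡⇒≡ᵇ m n e)

  interchange : ∀ a b c d → (a + b) + (c + d) ≡ (a + c) + (b + d)
  interchange = solve-∀

  module _ {J : Set} where

    sumOver : List J → (J → ℕ) → ℕ
    sumOver [] f = 0
    sumOver (j ∷ js) f = f j + sumOver js f

    anyOver : List J → (J → Bool) → Bool
    anyOver [] f = false
    anyOver (j ∷ js) f = f j ∨ anyOver js f

    sumOver-+ : ∀ js (f g : J → ℕ) → sumOver js (λ j → f j + g j) ≡ sumOver js f + sumOver js g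
    sumOver-+ [] f g = refl
    sumOver-+ (j ∷ js) f g rewrite sumOver-+ js f g = interchange (f j) (g j) _ _

    sumOver-mono : ∀ js (f g : J → ℕ) → (∀ j → f j ≤ g j) → sumOver js f ≤ sumOver js g
    sumOver-mono [] f g f≤g = z≤n
    sumOver-mono (j ∷ js) f g f≤g = +-mono-≤ (f≤g j) (sumOver-mono js f g f≤g)

    sumOver-*ʳ : ∀ js (f : J → ℕ) k → sumOver js (λ j → f j * k) ≡ sumOver js f * k
    sumOver-*ʳ [] f k = refl
    sumOver-*ʳ (j ∷ js) f k rewrite sumOver-*ʳ js f k = sym (*-distribʳ-+ k (f j) _)

    sumOver-*ˡ : ∀ js (f : J → ℕ) k → sumOver js (λ j → k * f j) ≡ k * sumOver js f
    sumOver-*ˡ [] f k = sym (*-zeroʳ k)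
    sumOver-*ˡ (j ∷ js) f k rewrite sumOver-*ˡ js f k = sym (*-distribˡ-+ k (f j) _)

    𝟙-anyOver : ∀ js (f : J → Bool) → 𝟙 (anyOver js f) ≤ sumOver js (λ j → 𝟙 (f j))
    𝟙-anyOver [] f = z≤n
    𝟙-anyOver (j ∷ js) f = ≤-trans (𝟙-∨ (f j) _) (+-monoʳ-≤ (𝟙 (f j)) (𝟙-anyOver js f))

    anyOver-true : ∀ js (f : J → Bool) {j} → Any (j ≡_) js → f j ≡ true → anyOver js f ≡ true
    anyOver-true (j ∷ js) f (here refl) fj rewrite fj = refl
    anyOver-true (j ∷ js) f (there j∈js) fj rewrite anyOver-true js f j∈js fj = ∨-zeroʳ (f j)

    anyOver-false : ∀ js (f : J → Bool) {j} → Any (j ≡_) js → anyOver js f ≡ false → f j ≡ false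
    anyOver-false (j ∷ js) f (here refl) none = ∨-conicalˡ (f j) _ none
    anyOver-false (j ∷ js) f (there j∈js) none = anyOver-false js f j∈js (∨-conicalʳ (f j) _ none)

    count-anyOver : ∀ js (q : J → ℕ → Bool) m →
      count (λ i → anyOver js (λ j → q j i)) m ≤ sumOver js (λ j → count (q j) m)
    count-anyOver js q zero = ≤-reflexive (sym (sumOver-zero js))
      where
      sumOver-zero : ∀ js → sumOver js (λ _ → 0) ≡ 0
      sumOver-zero [] = refl
      sumOver-zero (_ ∷ js) = sumOver-zero js
    count-anyOver js q (suc m) = begin
      𝟙 (anyOver js (λ j → q j m)) + count (λ i → anyOver js (λ j → q j i)) m
        ≤⟨ +-mono-≤ (𝟙-anyOver js (λ j → q j m)) (count-anyOver js q m) ⟩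
      sumOver js (λ j → 𝟙 (q j m)) + sumOver js (λ j → count (q j) m)
        ≡⟨ sumOver-+ js _ _ ⟨
      sumOver js (λ j → count (q j) (suc m)) ∎
      where open ≤-Reasoning

  count-∨ : ∀ (p q : ℕ → Bool) m → count (λ i → p i ∨ q i) m ≤ count p m + count q m
  count-∨ p q zero = z≤n
  count-∨ p q (suc m) = begin
    𝟙 (p m ∨ q m) + count (λ i → p i ∨ q i) m ≤⟨ +-mono-≤ (𝟙-∨ (p m) (q m)) (count-∨ p q m) ⟩
    (𝟙 (p m) + 𝟙 (q m)) + (count p m + count q m) ≡⟨ interchange (𝟙 (p m)) _ _ _ ⟩
    (𝟙 (p m) + count p m) + (𝟙 (q m) + count q m) ∎
    where open ≤-Reasoning

  count-∧ : ∀ b (p : ℕ → Bool) m → count (λ i → b ∧ p i) m ≤ 𝟙 b * count p m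
  count-∧ false p zero = z≤n
  count-∧ false p (suc m) = count-∧ false p m
  count-∧ true p m = ≤-reflexive (sym (+-identityʳ (count p m)))

  count-mono : ∀ (p q : ℕ → Bool) m → (∀ i → p i ≡ true → q i ≡ true) → count p m ≤ count q m
  count-mono p q zero p⇒q = z≤n
  count-mono p q (suc m) p⇒q = +-mono-≤ (𝟙-mono (p m) (q m) (p⇒q m)) (count-mono p q m p⇒q)
    where
    𝟙-mono : ∀ a b → (a ≡ true → b ≡ true) → 𝟙 a ≤ 𝟙 b
    𝟙-mono false b a⇒b = z≤n
    𝟙-mono true b a⇒b rewrite a⇒b refl = ≤-refl

  count-false : ∀ (p : ℕ → Bool) m → (∀ i → p i ≡ false) → count p m ≡ 0
  count-false p zero none = refl
  count-false p (suc m) none rewrite none m = count-false p m none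

  count-unique : ∀ (p : ℕ → Bool) m →
    (∀ i j → i < m → j < m → p i ≡ true → p j ≡ true → i ≡ j) → count p m ≤ 1
  count-unique p zero unique = z≤n
  count-unique p (suc m) unique with p m in pm
  ... | false = count-unique p m λ i j i<m j<m → unique i j (m<n⇒m<1+n i<m) (m<n⇒m<1+n j<m)
  ... | true = ≤-reflexive (cong suc (none-below m ≤-refl))
    where
    none-below : ∀ k → k ≤ m → count p k ≡ 0
    none-below zero _ = refl
    none-below (suc k) k<m with p k in pk
    ... | false = none-below k (<⇒≤ k<m)
    ... | true = ⊥-elim (<-irrefl (unique k m (m<n⇒m<1+n k<m) ≤-refl pk pm) k<m)

  count<⇒witness : ∀ (p : ℕ → Bool) m → count p m < m → ∃ λ i → i < m × p i ≡ false
  count<⇒witness p zero ()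
  count<⇒witness p (suc m) c<m with p m in pm
  ... | false = m , ≤-refl , pm
  ... | true with count<⇒witness p m (≤-pred c<m)
  ...   | i , i<m , pi = i , m<n⇒m<1+n i<m , pi

  count-split : ∀ (p : ℕ → Bool) K m → count p (m + K) ≡ count (λ i → p (K + i)) m + count p K
  count-split p K zero = refl
  count-split p K (suc m) rewrite count-split p K m | +-comm m K = sym (+-assoc (𝟙 (p (K + m))) _ _)

  range : ℕ → List ℕ
  range zero = []
  range (suc r) = r ∷ range r

  ∈-range : ∀ {c r} → c < r → Any (c ≡_) (range r)
  ∈-range {c} {suc r} c<r with c ≟ r
  ... | yes refl = here refl
  ... | no c≢r = there (∈-range (≤∧≢⇒< (≤-pred c<r) c≢r))

  sumOver-range-bound : ∀ r k (f : ℕ → ℕ) → (∀ i → f i ≤ k) → sumOver (range r) f ≤ r * k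
  sumOver-range-bound zero k f f≤k = z≤n
  sumOver-range-bound (suc r) k f f≤k = +-mono-≤ (f≤k r) (sumOver-range-bound r k f f≤k)

  sumOver-range-parity : ∀ K (f : ℕ → ℕ) →
    sumOver (range (2 * K)) f ≡ sumOver (range K) (λ i → f (2 * i)) + sumOver (range K) (λ i → f (suc (2 * i)))
  sumOver-range-parity zero f = refl
  sumOver-range-parity (suc K) f = begin
    sumOver (range (2 * suc K)) f ≡⟨ cong (λ z → sumOver (range z) f) (double-suc K) ⟩
    f (suc (2 * K)) + (f (2 * K) + sumOver (range (2 * K)) f)
      ≡⟨ cong (λ z → f (suc (2 * K)) + (f (2 * K) + z)) (sumOver-range-parity K f) ⟩
    f (suc (2 * K)) + (f (2 * K) + (sumOver (range K) (λ i → f (2 * i)) + sumOver (range K) (λ i → f (suc (2 * i)))))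
      ≡⟨ regroup (f (suc (2 * K))) (f (2 * K)) _ _ ⟩
    (f (2 * K) + sumOver (range K) (λ i → f (2 * i))) + (f (suc (2 * K)) + sumOver (range K) (λ i → f (suc (2 * i)))) ∎
    where
    open ≡-Reasoning
    double-suc : ∀ K → 2 * suc K ≡ suc (suc (2 * K))
    double-suc = solve-∀
    regroup : ∀ a b c d → a + (b + (c + d)) ≡ (b + c) + (a + d)
    regroup = solve-∀

module PowerOfTwoArithmetic where

  open import Data.Nat
  open import Data.Nat.Properties
  open import Data.Nat.DivMod
  open import Data.Nat.Divisibility
  open import Data.Sum using (_⊎_; inj₁; inj₂)
  open import Data.Product using (_×_; _,_)
  open import Relation.Binary.PropositionalEquality
  open import Relation.Nullary using (contradiction)
  open import Data.Nat.Tactic.RingSolver using (solve-∀)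

  _%2^_ : ℕ → ℕ → ℕ
  a %2^ m = _%_ a (2 ^ m) {{m^n≢0 2 m}}

  even-or-odd : ∀ b → b % 2 ≡ 0 ⊎ b % 2 ≡ 1
  even-or-odd b with b % 2 | m%n<n b 2
  ... | 0 | _ = inj₁ refl
  ... | 1 | _ = inj₂ refl
  ... | suc (suc _) | s≤s (s≤s ())

  %2^-parity : ∀ m a → 1 ≤ m → (a %2^ m) % 2 ≡ a % 2
  %2^-parity (suc m) a _ = m∣n⇒o%n%m≡o%m 2 (2 ^ suc m) a {{_}} {{m^n≢0 2 (suc m)}} (m∣m*n (2 ^ m))

  n<2^n : ∀ n → n < 2 ^ n
  n<2^n zero = s≤s z≤n
  n<2^n (suc n) = +-mono-≤ (m^n>0 2 n) (≤-trans (n<2^n n) (m≤m+n (2 ^ n) 0))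

  2∣2^ : ∀ m → 1 ≤ m → 2 ∣ 2 ^ m
  2∣2^ (suc m) _ = m∣m*n (2 ^ m)

  odd-number : ∀ i → suc (2 * i) % 2 ≡ 1
  odd-number i = trans (cong (_% 2) (reorder i)) ([m+kn]%n≡m%n 1 i 2)
    where
    reorder : ∀ i → suc (2 * i) ≡ 1 + i * 2
    reorder = solve-∀

  even-* : ∀ i x → (2 * i * x) % 2 ≡ 0
  even-* i x = trans (cong (_% 2) (reorder i x)) (m*n%n≡0 (i * x) 2)
    where
    reorder : ∀ i x → 2 * i * x ≡ i * x * 2
    reorder = solve-∀

  odd-* : ∀ i x → (suc (2 * i) * x) % 2 ≡ x % 2
  odd-* i x = trans (cong (_% 2) (reorder i x)) ([m+kn]%n≡m%n x (i * x) 2)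
    where
    reorder : ∀ i x → suc (2 * i) * x ≡ x + i * x * 2
    reorder = solve-∀

  odd-cancel-2 : ∀ c d → c % 2 ≡ 1 → 2 ∣ c * d → 2 ∣ d
  odd-cancel-2 c d c-odd 2∣cd = m%n≡0⇒n∣m d 2 (begin
    d % 2                   ≡⟨ m%n%n≡m%n d 2 ⟨
    (d % 2) % 2             ≡⟨ cong (_% 2) (*-identityˡ (d % 2)) ⟨
    (1 * (d % 2)) % 2       ≡⟨ cong (λ z → (z * (d % 2)) % 2) c-odd ⟨
    ((c % 2) * (d % 2)) % 2 ≡⟨ %-distribˡ-* c d 2 ⟨
    (c * d) % 2             ≡⟨ n∣m⇒m%n≡0 (c * d) 2 2∣cd ⟩
    0                       ∎)
    where open ≡-Reasoning

  odd-cancel : ∀ k c d → c % 2 ≡ 1 → 2 ^ k ∣ c * d → 2 ^ k ∣ d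
  odd-cancel zero c d c-odd _ = 1∣ d
  odd-cancel (suc k) c d c-odd 2^k+1∣cd with odd-cancel-2 c d c-odd (∣-trans (m∣m*n (2 ^ k)) 2^k+1∣cd)
  ... | divides q refl = subst (_∣ q * 2) (*-comm (2 ^ k) 2) (*-monoˡ-∣ 2 2^k∣q)
    where
    2^k∣q : 2 ^ k ∣ q
    2^k∣q = odd-cancel k c q c-odd (*-cancelʳ-∣ 2
      (subst₂ _∣_ (*-comm 2 (2 ^ k)) (sym (*-assoc c q 2)) 2^k+1∣cd))

  %-≡⇒∣∸ : ∀ a a' N .{{_ : NonZero N}} → a % N ≡ a' % N → N ∣ a' ∸ a
  %-≡⇒∣∸ a a' N a≡a' = divides (a' / N ∸ a / N) (begin
    a' ∸ a                                        ≡⟨ cong₂ _∸_ (m≡m%n+[m/n]*n a' N) (m≡m%n+[m/n]*n a N) ⟩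
    (a' % N + (a' / N) * N) ∸ (a % N + (a / N) * N)  ≡⟨ cong (λ z → (a' % N + (a' / N) * N) ∸ (z + (a / N) * N)) a≡a' ⟩
    (a' % N + (a' / N) * N) ∸ (a' % N + (a / N) * N) ≡⟨ [m+n]∸[m+o]≡n∸o (a' % N) _ _ ⟩
    (a' / N) * N ∸ (a / N) * N                     ≡⟨ *-distribʳ-∸ N (a' / N) (a / N) ⟨
    (a' / N ∸ a / N) * N                           ∎)
    where open ≡-Reasoning

  ∣∸⇒≡ : ∀ N y y' → y ≤ y' → y' < N → N ∣ y' ∸ y → y ≡ y'
  ∣∸⇒≡ N y y' y≤y' y'<N N∣y'-y = ≤-antisym y≤y' (m∸n≡0⇒m≤n (multiple-below (y' ∸ y) N∣y'-y (≤-<-trans (m∸n≤m y' y) y'<N)))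
    where
    multiple-below : ∀ d → N ∣ d → d < N → d ≡ 0
    multiple-below zero _ _ = refl
    multiple-below (suc d) N∣d d<N = contradiction N∣d (>⇒∤ d<N)

  ≤-wlog : (R : ℕ → ℕ → Set) → (∀ {y y'} → R y y' → R y' y) →
    (∀ {y y'} → y ≤ y' → R y y' → y ≡ y') → ∀ {y y'} → R y y' → y ≡ y'
  ≤-wlog R R-sym ≤⇒≡ {y} {y'} r with ≤-total y y'
  ... | inj₁ y≤y' = ≤⇒≡ y≤y' r
  ... | inj₂ y'≤y = sym (≤⇒≡ y'≤y (R-sym r))

  odd-*-injective : ∀ m c {x x'} → c % 2 ≡ 1 → x < 2 ^ m → x' < 2 ^ m →
    (c * x) %2^ m ≡ (c * x') %2^ m → x ≡ x'
  odd-*-injective m c c-odd x< x'< cx≡cx' = ≤-wlog R (λ (p , q , e) → q , p , sym e) ≤⇒≡ (x< , x'< , cx≡cx')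
    where
    instance
      2^m≢0 : NonZero (2 ^ m)
      2^m≢0 = m^n≢0 2 m
    R : ℕ → ℕ → Set
    R x x' = x < 2 ^ m × x' < 2 ^ m × (c * x) % 2 ^ m ≡ (c * x') % 2 ^ m
    ≤⇒≡ : ∀ {x x'} → x ≤ x' → R x x' → x ≡ x'
    ≤⇒≡ {x} {x'} x≤x' (_ , x'< , e) = ∣∸⇒≡ (2 ^ m) x x' x≤x' x'<
      (odd-cancel m c (x' ∸ x) c-odd (subst (2 ^ m ∣_) (sym (*-distribˡ-∸ c x' x)) (%-≡⇒∣∸ (c * x) (c * x') (2 ^ m) e)))

  +-injective : ∀ N .{{_ : NonZero N}} a {y y'} → y < N → y' < N → (a + y) % N ≡ (a + y') % N → y ≡ y'
  +-injective N a y< y'< a+y≡a+y' = ≤-wlog R (λ (p , q , e) → q , p , sym e) ≤⇒≡ (y< , y'< , a+y≡a+y')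
    where
    R : ℕ → ℕ → Set
    R y y' = y < N × y' < N × (a + y) % N ≡ (a + y') % N
    ≤⇒≡ : ∀ {y y'} → y ≤ y' → R y y' → y ≡ y'
    ≤⇒≡ {y} {y'} y≤y' (_ , y'< , e) = ∣∸⇒≡ N y y' y≤y' y'<
      (subst (N ∣_) ([m+n]∸[m+o]≡n∸o a y' y) (%-≡⇒∣∸ (a + y) (a + y') N e))

module OddMultiples where

  open import Data.Nat
  open import Data.Nat.Properties
  open import Data.Nat.DivMod
  open import Data.Nat.Divisibility
  open import Data.Bool using (Bool; true; false; _∧_; not)
  open import Data.Bool.Properties using (∧-conicalˡ; ∧-conicalʳ; ¬-not)
  open import Data.Product using (_×_; _,_)
  open import Data.Sum using (inj₁; inj₂)
  open import Relation.Binary.PropositionalEquality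
  open import Data.Nat.Tactic.RingSolver using (solve-∀)
  open Counting
  open PowerOfTwoArithmetic

  isOdd : ℕ → Bool
  isOdd x = x % 2 ≡ᵇ 1

  isPositive : ℕ → Bool
  isPositive c = not (c ≡ᵇ 0)

  count-even : ∀ K → count (λ x → not (isOdd x)) (2 * K) ≡ K
  count-even zero = refl
  count-even (suc K) = begin
    count (λ x → not (isOdd x)) (2 * suc K)
      ≡⟨ cong (count (λ x → not (isOdd x))) (double-suc K) ⟩
    𝟙 (not (isOdd (suc (2 * K)))) + (𝟙 (not (isOdd (2 * K))) + count (λ x → not (isOdd x)) (2 * K))
      ≡⟨ cong₂ (λ u v → 𝟙 (not (u ≡ᵇ 1)) + (𝟙 (not (v ≡ᵇ 1)) + count (λ x → not (isOdd x)) (2 * K)))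
               (odd-number K) (trans (cong (_% 2) (*-comm 2 K)) (m*n%n≡0 K 2)) ⟩
    1 + count (λ x → not (isOdd x)) (2 * K)
      ≡⟨ cong suc (count-even K) ⟩
    suc K ∎
    where
    open ≡-Reasoning
    double-suc : ∀ K → 2 * suc K ≡ suc (suc (2 * K))
    double-suc = solve-∀

  solves : ℕ → ℕ → ℕ → ℕ → Bool
  solves m c b x = isPositive c ∧ (isOdd x ∧ ((c * x) %2^ m ≡ᵇ b))

  solutions : ℕ → ℕ → ℕ → ℕ
  solutions m c b = count (solves m c b) (2 ^ m)

  solves⇒ : ∀ m c b x → solves m c b x ≡ true → 1 ≤ c × x % 2 ≡ 1 × (c * x) %2^ m ≡ b
  solves⇒ m (suc c) b x s = s≤s z≤n , ≡ᵇ-true⇒≡ (∧-conicalˡ _ _ s) , ≡ᵇ-true⇒≡ (∧-conicalʳ _ _ s)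

  ⇒solves : ∀ m c b x → 1 ≤ c → x % 2 ≡ 1 → (c * x) %2^ m ≡ b → solves m c b x ≡ true
  ⇒solves m (suc c) b x _ x-odd cx≡b rewrite x-odd | cx≡b = ≡⇒≡ᵇ-true {b} refl

  solutions-zero : ∀ m b → solutions m 0 b ≡ 0
  solutions-zero m b = count-false (solves m 0 b) (2 ^ m) λ _ → refl

  solutions-even-odd : ∀ m i b → 1 ≤ m → b % 2 ≡ 1 → solutions m (2 * i) b ≡ 0
  solutions-even-odd m i b 1≤m b-odd = count-false (solves m (2 * i) b) (2 ^ m) λ x → ¬-not λ s →
    let (_ , _ , 2ix≡b) = solves⇒ m (2 * i) b x s in 0≢1+n (begin
      0                          ≡⟨ even-* i x ⟨
      (2 * i * x) % 2            ≡⟨ %2^-parity m (2 * i * x) 1≤m ⟨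
      ((2 * i * x) %2^ m) % 2    ≡⟨ cong (_% 2) 2ix≡b ⟩
      b % 2                      ≡⟨ b-odd ⟩
      1                          ∎)
    where open ≡-Reasoning

  solutions-odd-even : ∀ m i b → 1 ≤ m → b % 2 ≡ 0 → solutions m (suc (2 * i)) b ≡ 0
  solutions-odd-even m i b 1≤m b-even = count-false (solves m (suc (2 * i)) b) (2 ^ m) λ x → ¬-not λ s →
    let (_ , x-odd , cx≡b) = solves⇒ m (suc (2 * i)) b x s in 0≢1+n (begin
      0                                 ≡⟨ b-even ⟨
      b % 2                             ≡⟨ cong (_% 2) cx≡b ⟨
      ((suc (2 * i) * x) %2^ m) % 2     ≡⟨ %2^-parity m _ 1≤m ⟩
      (suc (2 * i) * x) % 2             ≡⟨ odd-* i x ⟩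
      x % 2                             ≡⟨ x-odd ⟩
      1                                 ∎)
    where open ≡-Reasoning

  solutions-odd : ∀ m i b → solutions m (suc (2 * i)) b ≤ 1
  solutions-odd m i b = count-unique (solves m (suc (2 * i)) b) (2 ^ m) λ x x' x< x'< s s' →
    let (_ , _ , cx≡b) = solves⇒ m (suc (2 * i)) b x s
        (_ , _ , cx'≡b) = solves⇒ m (suc (2 * i)) b x' s'
    in odd-*-injective m (suc (2 * i)) (odd-number i) x< x'< (trans cx≡b (sym cx'≡b))

  double-mod : ∀ m i x → (2 * i * x) %2^ (suc m) ≡ ((i * x) %2^ m) * 2
  double-mod m i x = begin
    (2 * i * x) %2^ (suc m)                              ≡⟨ cong (_%2^ (suc m)) (reorder i x) ⟩
    _%_ (i * x * 2) (2 ^ suc m) {{m^n≢0 2 (suc m)}}      ≡⟨ %-congʳ {{m^n≢0 2 (suc m)}} {{2^m*2≢0}} (*-comm 2 (2 ^ m)) ⟩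
    _%_ (i * x * 2) (2 ^ m * 2) {{2^m*2≢0}}              ≡⟨ m%n*o≡m*o%[n*o] (i * x) (2 ^ m) 2 {{m^n≢0 2 m}} {{2^m*2≢0}} ⟨
    ((i * x) %2^ m) * 2                                  ∎
    where
    open ≡-Reasoning
    reorder : ∀ i x → 2 * i * x ≡ i * x * 2
    reorder = solve-∀
    2^m*2≢0 : NonZero (2 ^ m * 2)
    2^m*2≢0 = m*n≢0 (2 ^ m) 2 {{m^n≢0 2 m}}

  solves-halve : ∀ m i b x → solves (suc m) (2 * i) b x ≡ true → solves m i (b / 2) x ≡ true
  solves-halve m i b x s with solves⇒ (suc m) (2 * i) b x s
  solves-halve m (suc i) b x s | _ , x-odd , 2ix≡b = ⇒solves m (suc i) (b / 2) x (s≤s z≤n) x-odd (begin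
    (suc i * x) %2^ m              ≡⟨ m*n/n≡m _ 2 ⟨
    ((suc i * x) %2^ m) * 2 / 2    ≡⟨ cong (_/ 2) (double-mod m (suc i) x) ⟨
    (2 * suc i * x) %2^ (suc m) / 2 ≡⟨ cong (_/ 2) 2ix≡b ⟩
    b / 2                          ∎)
    where open ≡-Reasoning

  solves-shift : ∀ m i b x → 1 ≤ m → solves (suc m) (2 * i) b (2 ^ m + x) ≡ solves (suc m) (2 * i) b x
  solves-shift m i b x 1≤m = cong₂ (λ u v → isPositive (2 * i) ∧ ((u ≡ᵇ 1) ∧ (v ≡ᵇ b))) parity-shift product-shift
    where
    parity-shift : (2 ^ m + x) % 2 ≡ x % 2
    parity-shift = %-remove-+ˡ x (2∣2^ m 1≤m)
    expand : ∀ i K x → 2 * i * (K + x) ≡ i * (2 * K) + 2 * i * x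
    expand = solve-∀
    product-shift : (2 * i * (2 ^ m + x)) %2^ (suc m) ≡ (2 * i * x) %2^ (suc m)
    product-shift = trans (cong (_%2^ (suc m)) (expand i (2 ^ m) x)) (%-remove-+ˡ (2 * i * x) {{m^n≢0 2 (suc m)}} (n∣m*n i))

  solutions-halve : ∀ m i b → 1 ≤ m → solutions (suc m) (2 * i) b ≤ 2 * solutions m i (b / 2)
  solutions-halve m i b 1≤m = begin
    count (solves (suc m) (2 * i) b) (2 ^ suc m)
      ≡⟨ cong (count (solves (suc m) (2 * i) b)) (cong (2 ^ m +_) (+-identityʳ (2 ^ m))) ⟩
    count (solves (suc m) (2 * i) b) (2 ^ m + 2 ^ m)
      ≡⟨ count-split _ (2 ^ m) (2 ^ m) ⟩
    count (λ x → solves (suc m) (2 * i) b (2 ^ m + x)) (2 ^ m) + count (solves (suc m) (2 * i) b) (2 ^ m)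
      ≤⟨ +-mono-≤ (count-mono _ _ (2 ^ m) λ x s → solves-halve m i b x (trans (sym (solves-shift m i b x 1≤m)) s))
                  (count-mono _ _ (2 ^ m) (solves-halve m i b)) ⟩
    solutions m i (b / 2) + solutions m i (b / 2)
      ≡⟨ cong (solutions m i (b / 2) +_) (+-identityʳ _) ⟨
    2 * solutions m i (b / 2) ∎
    where open ≤-Reasoning

  -- the key lemma, by induction on l together with the bound for even multipliers
  multiplierBound : ∀ l m b → suc l ≤ m → sumOver (range (2 ^ suc l)) (λ c → solutions m c b) ≤ 2 ^ l

  evenMultiplierBound : ∀ l m b → suc l ≤ m → sumOver (range (2 ^ l)) (λ i → solutions m (2 * i) b) ≤ 2 ^ l
  evenMultiplierBound zero m b _ = ≤-trans (≤-reflexive (trans (+-identityʳ _) (solutions-zero m b))) z≤n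
  evenMultiplierBound (suc l) (suc m) b (s≤s l<m) = begin
    sumOver (range (2 ^ suc l)) (λ i → solutions (suc m) (2 * i) b)
      ≤⟨ sumOver-mono (range (2 ^ suc l)) _ _ (λ i → solutions-halve m i b (≤-trans (s≤s z≤n) l<m)) ⟩
    sumOver (range (2 ^ suc l)) (λ i → 2 * solutions m i (b / 2))
      ≡⟨ sumOver-*ˡ (range (2 ^ suc l)) _ 2 ⟩
    2 * sumOver (range (2 ^ suc l)) (λ i → solutions m i (b / 2))
      ≤⟨ *-monoʳ-≤ 2 (multiplierBound l m (b / 2) l<m) ⟩
    2 * 2 ^ l ∎
    where open ≤-Reasoning

  -- split the multipliers c < 2^(l+1) by parity; only those of the parity of b contribute
  multiplierBound l m b l<m with even-or-odd b
  ... | inj₂ b-odd = begin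
    sumOver (range (2 * 2 ^ l)) (λ c → solutions m c b)
      ≡⟨ sumOver-range-parity (2 ^ l) _ ⟩
    sumOver (range (2 ^ l)) (λ i → solutions m (2 * i) b) + sumOver (range (2 ^ l)) (λ i → solutions m (suc (2 * i)) b)
      ≤⟨ +-mono-≤ (sumOver-range-bound (2 ^ l) 0 _ λ i → ≤-reflexive (solutions-even-odd m i b 1≤m b-odd))
                  (sumOver-range-bound (2 ^ l) 1 _ λ i → solutions-odd m i b) ⟩
    2 ^ l * 0 + 2 ^ l * 1
      ≡⟨ cong₂ _+_ (*-zeroʳ (2 ^ l)) (*-identityʳ (2 ^ l)) ⟩
    2 ^ l ∎
    where
    open ≤-Reasoning
    1≤m = ≤-trans (s≤s z≤n) l<m
  ... | inj₁ b-even = begin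
    sumOver (range (2 * 2 ^ l)) (λ c → solutions m c b)
      ≡⟨ sumOver-range-parity (2 ^ l) _ ⟩
    sumOver (range (2 ^ l)) (λ i → solutions m (2 * i) b) + sumOver (range (2 ^ l)) (λ i → solutions m (suc (2 * i)) b)
      ≤⟨ +-mono-≤ (evenMultiplierBound l m b l<m)
                  (sumOver-range-bound (2 ^ l) 0 _ λ i → ≤-reflexive (solutions-odd-even m i b 1≤m b-even)) ⟩
    2 ^ l + 2 ^ l * 0
      ≡⟨ trans (cong (2 ^ l +_) (*-zeroʳ (2 ^ l))) (+-identityʳ _) ⟩
    2 ^ l ∎
    where
    open ≤-Reasoning
    1≤m = ≤-trans (s≤s z≤n) l<m

open import Data.Nat using (zero; suc; _+_; _≡ᵇ_; s≤s; z≤n)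
open import Data.Nat.Properties
open import Data.Nat.DivMod using (_%_; m%n%n≡m%n)
open import Data.Integer as ℤ using (+_)
open import Data.Fin as F using (toℕ)
open import Data.Fin.Properties using (toℕ-fromℕ<)
open import Data.Fin.Subset using (Nonempty)
open import Data.Vec as V using (Vec; lookup)
open import Data.Vec.Properties using (lookup⇒[]=)
open import Data.List using (length; allFin; tabulate)
open import Data.List.Membership.Propositional.Properties using (∈-allFin)
open import Data.Bool using (Bool; true; false; _∨_; _∧_; not)
open import Data.Bool.Properties using (∨-conicalˡ; ∨-conicalʳ; ∧-identityʳ; not-involutive)
open import Data.Product using (∃; _×_; _,_; proj₁; proj₂)
open import Data.Sum using (_⊎_; inj₁; inj₂)
open import Relation.Binary.PropositionalEquality
open Counting
open PowerOfTwoArithmetic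
open OddMultiples

subsetSum-shape : ∀ k (x y : ℕ) (I : Subset (length (xsy k (+ x) (+ y)))) →
  ∃ λ c → c ≤ k × (selSum I (fromList (xsy k (+ x) (+ y))) ≡ + (c * x) × (Nonempty I → 1 ≤ c)
                  ⊎ selSum I (fromList (xsy k (+ x) (+ y))) ≡ + (c * x + y))
subsetSum-shape zero x y (true V.∷ V.[]) = 0 , z≤n , inj₂ (cong +_ (+-identityʳ y))
subsetSum-shape zero x y (false V.∷ V.[]) = 0 , z≤n , inj₁ (refl , λ { (F.zero , ()) })
subsetSum-shape (suc k) x y (true V.∷ I) with subsetSum-shape k x y I
... | c , c≤k , inj₁ (s≡cx , _) = suc c , s≤s c≤k , inj₁ (cong (ℤ._+_ (+ x)) s≡cx , λ _ → s≤s z≤n)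
... | c , c≤k , inj₂ s≡cx+y = suc c , s≤s c≤k , inj₂ (trans (cong (ℤ._+_ (+ x)) s≡cx+y) (cong +_ (sym (+-assoc x (c * x) y))))
subsetSum-shape (suc k) x y (false V.∷ I) with subsetSum-shape k x y I
... | c , c≤k , inj₁ (s≡cx , 1≤c) = c , m≤n⇒m≤1+n c≤k , inj₁ (s≡cx , λ { (F.zero , ()) ; (F.suc i , V.there i∈I) → 1≤c (i , i∈I) })
... | c , c≤k , inj₂ s≡cx+y = c , m≤n⇒m≤1+n c≤k , inj₂ s≡cx+y

complement-size : ∀ {X : Set} m (A : Subset m) (h : Fin m → X) (f : X → ℕ) →
  (∀ i → f (h i) ≡ 𝟙 (not (lookup A i))) → sumOver (tabulate h) f + ∣ A ∣ ≡ m
complement-size zero V.[] h f f∘h = refl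
complement-size (suc m) (true V.∷ A) h f f∘h rewrite f∘h F.zero =
  trans (+-suc _ _) (cong suc (complement-size m A (λ i → h (F.suc i)) f (λ i → f∘h (F.suc i))))
complement-size (suc m) (false V.∷ A) h f f∘h rewrite f∘h F.zero =
  cong suc (complement-size m A (λ i → h (F.suc i)) f (λ i → f∘h (F.suc i)))

density⇒small-complement : ∀ L N a b → b + a ≡ N → (L ∸ 1) * N < L * a → L * b < N
density⇒small-complement (suc L′) N a b refl density = +-monoʳ-< b (+-cancelʳ-< (L′ * a) (L′ * b) a
  (subst (_< a + L′ * a) (*-distribˡ-+ L′ b a) density))

reduce-toℕ : ∀ n (t : Fin (2 ^ n)) {s} v → s ≡ + v → reduce (2 ^ n) {{m^n≢0 2 n}} s ≡ t → v %2^ n ≡ toℕ t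
reduce-toℕ n t v refl s↦t = begin
  v %2^ n                               ≡⟨ m%n%n≡m%n v (2 ^ n) {{m^n≢0 2 n}} ⟨
  _%_ (v %2^ n) (2 ^ n) {{m^n≢0 2 n}}   ≡⟨ toℕ-fromℕ< _ ⟨
  toℕ (reduce (2 ^ n) {{m^n≢0 2 n}} (+ v)) ≡⟨ cong toℕ s↦t ⟩
  toℕ t                                 ∎
  where open ≡-Reasoning

≤∸1⇒< : ∀ {c L} → 1 ≤ L → c ≤ L ∸ 1 → c < L
≤∸1⇒< {L = suc L} _ c≤ = s≤s c≤

module Construction (l n′ : ℕ) (A : Subset (2 ^ suc n′)) where

  n N L : ℕ
  n = suc n′
  N = 2 ^ n
  L = 2 ^ suc l

  instance
    N≢0 : NonZero N
    N≢0 = m^n≢0 2 n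

  inB : Fin N → Bool
  inB t = not (lookup A t)

  |B| : ℕ
  |B| = sumOver (allFin N) (λ t → 𝟙 (inB t))

  hits : (ℕ → Fin N → ℕ → Bool) → ℕ → Bool
  hits q z = anyOver (allFin N) (λ t → inB t ∧ anyOver (range L) (λ c → q c t z))

  hits-bound : ∀ q k → (∀ t → sumOver (range L) (λ c → count (q c t) N) ≤ k) → count (hits q) N ≤ |B| * k
  hits-bound q k per-target = begin
    count (hits q) N
      ≤⟨ count-anyOver (allFin N) _ N ⟩
    sumOver (allFin N) (λ t → count (λ z → inB t ∧ anyOver (range L) (λ c → q c t z)) N)
      ≤⟨ sumOver-mono (allFin N) _ _ per-B-element ⟩
    sumOver (allFin N) (λ t → 𝟙 (inB t) * k)
      ≡⟨ sumOver-*ʳ (allFin N) _ k ⟩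
    |B| * k ∎
    where
    open ≤-Reasoning
    per-B-element : ∀ t → count (λ z → inB t ∧ anyOver (range L) (λ c → q c t z)) N ≤ 𝟙 (inB t) * k
    per-B-element t = ≤-trans (count-∧ (inB t) _ N)
      (*-monoʳ-≤ (𝟙 (inB t)) (≤-trans (count-anyOver (range L) (λ c → q c t) N) (per-target t)))

  miss⇒∈A : ∀ q z → hits q z ≡ false → ∀ t c → c < L → q c t z ≡ true → t ∈ A
  miss⇒∈A q z miss t c c<L qctz = lookup⇒[]= t A (not-false⇒true (∧-false (inB t) t-miss reached))
    where
    t-miss : inB t ∧ anyOver (range L) (λ c → q c t z) ≡ false
    t-miss = anyOver-false (allFin N) _ (∈-allFin t) miss
    reached : anyOver (range L) (λ c → q c t z) ≡ true
    reached = anyOver-true (range L) _ (∈-range c<L) qctz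
    ∧-false : ∀ a {b} → a ∧ b ≡ false → b ≡ true → a ≡ false
    ∧-false a a∧b≡false refl = trans (sym (∧-identityʳ a)) a∧b≡false
    not-false⇒true : ∀ {a} → not a ≡ false → a ≡ true
    not-false⇒true {a} e = trans (sym (not-involutive a)) (cong not e)

  GoodMultiplier : ℕ → Set
  GoodMultiplier x = ∀ (t : Fin N) c → 1 ≤ c → c < L → (c * x) %2^ n ≡ toℕ t → t ∈ A

  GoodShift : ℕ → ℕ → Set
  GoodShift x y = ∀ (t : Fin N) c → c < L → (c * x + y) %2^ n ≡ toℕ t → t ∈ A

  -- fewer than N/2 + |B|·L/2 < N residues are even or hit B as an odd multiplier
  goodMultiplier : suc l ≤ n → L * |B| < N → ∃ GoodMultiplier
  goodMultiplier l<n small = x , λ t c 1≤c c<L cx≡t →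
    miss⇒∈A multiplierHits x x-misses t c c<L (⇒solves n c (toℕ t) x 1≤c x-odd cx≡t)
    where
    open ≤-Reasoning
    multiplierHits : ℕ → Fin N → ℕ → Bool
    multiplierHits c t = solves n c (toℕ t)
    bad : ℕ → Bool
    bad x = not (isOdd x) ∨ hits multiplierHits x
    half-small : |B| * 2 ^ l < 2 ^ n′
    half-small = *-cancelˡ-< 2 (|B| * 2 ^ l) (2 ^ n′)
      (subst (_< N) (trans (*-assoc 2 (2 ^ l) |B|) (cong (2 *_) (*-comm (2 ^ l) |B|))) small)
    few-bad : count bad N < N
    few-bad = begin-strict
      count bad N
        ≤⟨ count-∨ _ _ N ⟩
      count (λ x → not (isOdd x)) N + count (hits multiplierHits) N
        ≤⟨ +-mono-≤ (≤-reflexive (count-even (2 ^ n′)))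
                    (hits-bound multiplierHits (2 ^ l) λ t → multiplierBound l n (toℕ t) l<n) ⟩
      2 ^ n′ + |B| * 2 ^ l
        <⟨ +-monoʳ-< (2 ^ n′) half-small ⟩
      2 ^ n′ + 2 ^ n′
        ≡⟨ cong (_+_ (2 ^ n′)) (+-identityʳ _) ⟨
      N ∎
    x-witness : ∃ λ x → x < N × bad x ≡ false
    x-witness = count<⇒witness bad N few-bad
    x : ℕ
    x = proj₁ x-witness
    x-good : bad x ≡ false
    x-good = proj₂ (proj₂ x-witness)
    x-odd : x % 2 ≡ 1
    x-odd = ≡ᵇ-true⇒≡ (trans (sym (not-involutive (isOdd x))) (cong not (∨-conicalˡ _ _ x-good)))
    x-misses : hits multiplierHits x ≡ false
    x-misses = ∨-conicalʳ _ _ x-good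

  -- each pair (c, t) forbids at most one shift y, so at most L·|B| < N shifts are bad
  goodShift : ∀ x → L * |B| < N → ∃ (GoodShift x)
  goodShift x small = y , λ t c c<L e → miss⇒∈A shiftHits y y-misses t c c<L (≡⇒≡ᵇ-true e)
    where
    open ≤-Reasoning
    shiftHits : ℕ → Fin N → ℕ → Bool
    shiftHits c t y = (c * x + y) %2^ n ≡ᵇ toℕ t
    one-shift : ∀ c t → count (shiftHits c t) N ≤ 1
    one-shift c t = count-unique _ N λ y y′ y< y′< e e′ →
      +-injective N (c * x) y< y′< (trans (≡ᵇ-true⇒≡ e) (sym (≡ᵇ-true⇒≡ e′)))
    few-bad : count (hits shiftHits) N < N
    few-bad = begin-strict
      count (hits shiftHits) N
        ≤⟨ hits-bound shiftHits (L * 1) (λ t → sumOver-range-bound L 1 _ λ c → one-shift c t) ⟩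
      |B| * (L * 1)
        ≡⟨ trans (cong (|B| *_) (*-identityʳ L)) (*-comm |B| L) ⟩
      L * |B|
        <⟨ small ⟩
      N ∎
    y-witness : ∃ λ y → y < N × hits shiftHits y ≡ false
    y-witness = count<⇒witness (hits shiftHits) N few-bad
    y : ℕ
    y = proj₁ y-witness
    y-misses : hits shiftHits y ≡ false
    y-misses = proj₂ (proj₂ y-witness)

  subsetSums⊆A : ∀ x y → GoodMultiplier x → GoodShift x y →
    ∀ t → Σ* N (fromList (xsy (L ∸ 1) (+ x) (+ y))) t → t ∈ A
  subsetSums⊆A x y x-good y-good t (I , nonempty , sum≡t) with subsetSum-shape (L ∸ 1) x y I
  ... | c , c≤ , inj₁ (sum≡cx , 1≤c) =
    x-good t c (1≤c nonempty) (≤∸1⇒< (m^n>0 2 (suc l)) c≤) (reduce-toℕ n t (c * x) sum≡cx sum≡t)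
  ... | c , c≤ , inj₂ sum≡cx+y =
    y-good t c (≤∸1⇒< (m^n>0 2 (suc l)) c≤) (reduce-toℕ n t (c * x + y) sum≡cx+y sum≡t)

theorem2p1 : (ℓ n : ℕ) → 1 ≤ ℓ → 1 ≤ n → 2 ^ ℓ ≤ n →
    (A : Subset (2 ^ n)) →
    (2 ^ ℓ ∸ 1) * 2 ^ n < 2 ^ ℓ * ∣ A ∣ →
    ∃₂ λ (x y : ℤ) →
      ∀ (t : Fin (2 ^ n)) → Σ* (2 ^ n) {{m^n≢0 2 n}} (fromList (xsy (2 ^ ℓ ∸ 1) x y)) t → t ∈ A
theorem2p1 (suc l) (suc n′) _ _ 2^ℓ≤n A density = + x , + y , subsetSums⊆A x y x-good y-good
  where
  open Construction l n′ A
  ℓ≤n : suc l ≤ suc n′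
  ℓ≤n = <⇒≤ (<-≤-trans (n<2^n (suc l)) 2^ℓ≤n)
  small : L * |B| < N
  small = density⇒small-complement L N ∣ A ∣ |B| (complement-size N A (λ t → t) (λ t → 𝟙 (inB t)) (λ _ → refl)) density
  x : ℕ
  x = proj₁ (goodMultiplier ℓ≤n small)
  x-good : GoodMultiplier x
  x-good = proj₂ (goodMultiplier ℓ≤n small)
  y : ℕ
  y = proj₁ (goodShift x small)
  y-good : GoodShift x y
  y-good = proj₂ (goodShift x small)
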